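{- Let $G$ be a finite simple graph. For every vertex $v\in V(G)$ it holds that $\gamma_g^t(G|v) \geq \gamma_g^t(G) - 2$.
   Context: The total domination game on a graph $G$ in which a set $S\subseteq V(G)$ is predominated: two players, Dominator and Staller, alternately choose vertices of $G$. A vertex $w$ is totally dominated if it lies in $S$ or if some neighbor of $w$ has already been chosen (a vertex does not totally dominate itself). A vertex may be chosen (is a legal move) only if it has at least one neighbor that is not yet totally dominated. The game ends when no legal move remains. Dominator aims to minimize and Staller to maximize the total number of chosen vertices. $\gamma_g^t(G|S)$ denotes the number of moves when Dominator makes the first move and both players play optimally; $\gamma_g^t(G)=\gamma_g^t(G|\emptyset)$, and $\gamma_g^t(G|v)=\gamma_g^t(G|\{v\})$. -}

module Defs where

open import Data.Nat using (ℕ; zero; suc; _⊓_; _⊔_)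
open import Data.Bool using (Bool; true; false; _∧_; _∨_; not)
open import Data.Fin using (Fin)
open import Data.Fin.Properties using (_≟_)
open import Data.List using (List; []; _∷_; map; foldr; allFin; filterᵇ)
open import Data.Bool.ListAction using (any)
open import Relation.Binary.PropositionalEquality using (_≡_)
open import Relation.Nullary.Decidable using (⌊_⌋)

record Graph (n : ℕ) : Set where
  field
    adj    : Fin n → Fin n → Bool
    sym    : ∀ i j → adj i j ≡ adj j i
    irrefl : ∀ i → adj i i ≡ false
open Graph public

VSet : ℕ → Set
VSet n = Fin n → Bool

∅ : ∀ {n} → VSet n
∅ _ = false

｛_｝ : ∀ {n} → Fin n → VSet n
｛ v ｝ u = ⌊ u ≟ v ⌋

data Player : Set where
  Dominator Staller : Player

other : Player → Player
other Dominator = Staller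
other Staller   = Dominator

module _ {n : ℕ} (G : Graph n) where

  -- v is a legal move when D is the set of totally dominated vertices:
  -- v has a neighbour that is not yet totally dominated.
  legal : VSet n → Fin n → Bool
  legal D v = any (λ u → adj G v u ∧ not (D u)) (allFin n)

  legalMoves : VSet n → List (Fin n)
  legalMoves D = filterᵇ (legal D) (allFin n)

  play : VSet n → Fin n → VSet n
  play D v u = D u ∨ adj G v u

  optimum : Player → ℕ → List ℕ → ℕ
  optimum Dominator x xs = foldr _⊓_ x xs
  optimum Staller   x xs = foldr _⊔_ x xs

  value : ℕ → Player → VSet n → ℕ
  value zero    p D = 0
  value (suc k) p D with legalMoves D
  ... | []     = 0
  ... | v ∷ vs = optimum p (f v) (map f vs)
    where f : Fin n → ℕ
          f w = suc (value k (other p) (play D w))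

  -- Every legal move totally dominates at least one new vertex, so the game
  -- lasts at most n moves; budget n therefore gives the exact game value.
  -- γ_g^t(G | S): Dominator starts, S predominated.
  γgt : VSet n → ℕ
  γgt S = value n Dominator S

-- Write  D ≼ D'  when every vertex of D that has a neighbour also lies in D'.
-- Only such vertices influence legality, so D' is then "at least as far
-- advanced" as D.  From this a
--      continuation principle follows by induction on the budget: the value
--      decreases when more is dominated and increases with the budget.
--   3. Predominating v: if v is isolated or already dominated, nothing
--      changes.  Otherwise Dominator opens with a neighbour u of v; after
--      Staller's reply everything in D ∪ {v} is dominated, so by the
--      continuation principle the game lasts at most two moves longer.
module Submission where

open import Defs hiding (sym)
open import Data.Nat using (ℕ; zero; suc; _≤_; _+_; _⊓_; _⊔_; z≤n; s≤s)
open import Data.Nat.Properties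
  using (≤-refl; ≤-reflexive; ≤-trans; ⊓-sel; ⊔-sel; m≤n⇒m⊓o≤n; m≤n⇒o⊓m≤n;
         m≤n⇒m≤n⊔o; m≤n⇒m≤o⊔n; m≤n+m; m≤m+n; +-comm; module ≤-Reasoning)
open import Data.Bool using (true; false; not; _∨_; T; T?)
open import Data.Bool.Properties using (T-∧; T-∨)
open import Data.Unit using (tt)
open import Data.Empty using (⊥-elim)
open import Data.Fin using (Fin)
open import Data.Fin.Properties using (any?; _≟_)
open import Data.Product using (∃; _×_; _,_; proj₂)
open import Data.Sum using (_⊎_; inj₁; inj₂; [_,_]′)
import Data.Sum as Sum
open import Data.List using ([]; _∷_; map; foldr; allFin)
open import Data.List.Relation.Unary.Any as Any using (here; there)
open import Data.List.Relation.Unary.Any.Properties using (any⁺; any⁻; map⁺; ¬Any[])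
open import Data.List.Membership.Propositional using (_∈_; lose)
open import Data.List.Membership.Propositional.Properties
  using (∈-allFin; ∈-filter⁺; ∈-filter⁻; ∈-map⁻; foldr-selective)
open import Data.List.Properties using (foldr-preservesᵒ)
open import Algebra.Definitions using (Selective)
open import Function using (_∘_; id; _⇔_; mk⇔; Equivalence)
open import Relation.Binary.PropositionalEquality using (_≡_; refl; sym; subst)
open import Relation.Nullary using (¬_; yes; no)
open import Relation.Nullary.Decidable using (decidable-stable; toWitness)

open Equivalence using (to; from)

T-not⇔¬T : ∀ {b} → T (not b) ⇔ (¬ T b)
T-not⇔¬T {false} = mk⇔ (λ _ ()) (λ _ → tt)
T-not⇔¬T {true}  = mk⇔ (λ ()) (λ ¬tt → ¬tt tt)

module _ {n : ℕ} (G : Graph n) {A : Set} (f : A → ℕ) where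

  fold-attained : ∀ {_•_} → Selective _≡_ _•_ →
    ∀ x xs → ∃ λ y → y ∈ x ∷ xs × foldr _•_ (f x) (map f xs) ≡ f y
  fold-attained sel x xs with foldr-selective sel (f x) (map f xs)
  ... | inj₁ eq = x , here refl , eq
  ... | inj₂ m∈ with ∈-map⁻ f m∈
  ...   | y , y∈ , eq = y , there y∈ , eq

  optimum-attained : ∀ p x xs → ∃ λ y → y ∈ x ∷ xs × optimum G p (f x) (map f xs) ≡ f y
  optimum-attained Dominator = fold-attained ⊓-sel
  optimum-attained Staller   = fold-attained ⊔-sel

  optimum-Dominator-≤ : ∀ {x xs y} → y ∈ x ∷ xs → optimum G Dominator (f x) (map f xs) ≤ f y
  optimum-Dominator-≤ {x} {xs} {y} y∈ =
    foldr-preservesᵒ {P = _≤ f y} pres (f x) (map f xs) (located y∈)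
    where
    pres : ∀ a b → a ≤ f y ⊎ b ≤ f y → a ⊓ b ≤ f y
    pres a b = [ m≤n⇒m⊓o≤n b , m≤n⇒o⊓m≤n a ]′
    located : ∀ {zs} → y ∈ x ∷ zs → f x ≤ f y ⊎ Any.Any (_≤ f y) (map f zs)
    located (here refl) = inj₁ ≤-refl
    located (there y∈zs) = inj₂ (map⁺ (Any.map (λ { refl → ≤-refl }) y∈zs))

  optimum-Staller-≥ : ∀ {x xs y} → y ∈ x ∷ xs → f y ≤ optimum G Staller (f x) (map f xs)
  optimum-Staller-≥ {x} {xs} {y} y∈ =
    foldr-preservesᵒ {P = f y ≤_} pres (f x) (map f xs) (located y∈)
    where
    pres : ∀ a b → f y ≤ a ⊎ f y ≤ b → f y ≤ a ⊔ b
    pres a b = [ m≤n⇒m≤n⊔o b , m≤n⇒m≤o⊔n a ]′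
    located : ∀ {zs} → y ∈ x ∷ zs → f y ≤ f x ⊎ Any.Any (f y ≤_) (map f zs)
    located (here refl) = inj₁ ≤-refl
    located (there y∈zs) = inj₂ (map⁺ (Any.map (λ { refl → ≤-refl }) y∈zs))

module _ {n : ℕ} (G : Graph n) where

  Legal : VSet n → Fin n → Set
  Legal D w = T (legal G D w)

  legal-witness : ∀ {D w} → Legal D w → ∃ λ u → T (adj G w u) × ¬ T (D u)
  legal-witness {D} {w} lw with Any.satisfied (any⁻ _ (allFin n) lw)
  ... | u , h with to T-∧ h
  ...   | w~u , u∉D = u , w~u , to T-not⇔¬T u∉D

  legal-intro : ∀ {D w u} → T (adj G w u) → ¬ T (D u) → Legal D w
  legal-intro {D} {w} {u} w~u u∉D =
    any⁺ _ (lose (∈-allFin u) (from T-∧ (w~u , from T-not⇔¬T u∉D)))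

  illegal-dominated : ∀ {D w u} → ¬ Legal D w → T (adj G w u) → T (D u)
  illegal-dominated {D} {u = u} ¬lw w~u =
    decidable-stable (T? (D u)) (λ u∉D → ¬lw (legal-intro w~u u∉D))

  legal⇒∈ : ∀ {D w} → Legal D w → w ∈ legalMoves G D
  legal⇒∈ {D} {w} = ∈-filter⁺ (T? ∘ legal G D) (∈-allFin w)

  ∈⇒legal : ∀ {D w} → w ∈ legalMoves G D → Legal D w
  ∈⇒legal {D} = proj₂ ∘ ∈-filter⁻ (T? ∘ legal G D) {xs = allFin n}

  _≼_ : VSet n → VSet n → Set
  D ≼ D' = ∀ w u → T (adj G w u) → T (D u) → T (D' u)

  legal-antitone : ∀ {D D' w} → D ≼ D' → Legal D' w → Legal D w
  legal-antitone D≼D' lw with legal-witness lw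
  ... | u , w~u , u∉D' = legal-intro w~u (λ u∈D → u∉D' (D≼D' _ u w~u u∈D))

  play-mono : ∀ {D D'} → D ≼ D' → ∀ x → play G D x ≼ play G D' x
  play-mono D≼D' x w u w~u = from T-∨ ∘ Sum.map (D≼D' w u w~u) id ∘ to T-∨

  ≼-play : ∀ {D D'} → D ≼ D' → ∀ z → D ≼ play G D' z
  ≼-play D≼D' z w u w~u = from T-∨ ∘ inj₁ ∘ D≼D' w u w~u

  play-illegal : ∀ {D D' x} → D ≼ D' → ¬ Legal D' x → play G D x ≼ D'
  play-illegal D≼D' ¬lx w u w~u =
    [ D≼D' w u w~u , illegal-dominated ¬lx ]′ ∘ to T-∨

  value-stuck : ∀ k p {D} → (∀ w → ¬ Legal D w) → value G (suc k) p D ≡ 0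
  value-stuck k p {D} stuck with legalMoves G D in eq
  ... | []    = refl
  ... | x ∷ _ = ⊥-elim (stuck x (∈⇒legal (subst (x ∈_) (sym eq) (here refl))))

  value-stuck-≤ : ∀ k p {D m} → (∀ w → ¬ Legal D w) → value G (suc k) p D ≤ m
  value-stuck-≤ k p stuck = ≤-trans (≤-reflexive (value-stuck k p stuck)) z≤n

  value-attained : ∀ k p D → (∀ w → ¬ Legal D w) ⊎
    ∃ λ w → Legal D w × value G (suc k) p D ≡ suc (value G k (other p) (play G D w))
  value-attained k p D with legalMoves G D in eq
  ... | []     = inj₁ (λ w lw → ¬Any[] (subst (w ∈_) eq (legal⇒∈ lw)))
  ... | x ∷ xs with optimum-attained G (λ w → suc (value G k (other p) (play G D w))) p x xs
  ...   | y , y∈ , e = inj₂ (y , ∈⇒legal (subst (y ∈_) (sym eq) y∈) , e)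

  value-Dominator-≤ : ∀ k {D w} → Legal D w →
    value G (suc k) Dominator D ≤ suc (value G k Staller (play G D w))
  value-Dominator-≤ k {D} {w} lw with legalMoves G D in eq
  ... | []     = z≤n
  ... | x ∷ xs = optimum-Dominator-≤ G (λ w → suc (value G k Staller (play G D w)))
                   (subst (w ∈_) eq (legal⇒∈ lw))

  value-Staller-≥ : ∀ k {D w} → Legal D w →
    suc (value G k Dominator (play G D w)) ≤ value G (suc k) Staller D
  value-Staller-≥ k {D} {w} lw with legalMoves G D in eq
  ... | []     = ⊥-elim (¬Any[] (subst (w ∈_) eq (legal⇒∈ lw)))
  ... | x ∷ xs = optimum-Staller-≥ G (λ w → suc (value G k Dominator (play G D w)))
                   (subst (w ∈_) eq (legal⇒∈ lw))

  value-Staller-≤ : ∀ k {D b} → (∀ y → Legal D y → value G k Dominator (play G D y) ≤ b) →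
    value G (suc k) Staller D ≤ suc b
  value-Staller-≤ k {D} bound with value-attained k Staller D
  ... | inj₁ stuck = value-stuck-≤ k Staller stuck
  ... | inj₂ (y , ly , eq) = ≤-trans (≤-reflexive eq) (s≤s (bound y ly))

  matching-move : ∀ {D D'} → D ≼ D' → ∀ y →
    (∀ w → ¬ Legal D' w) ⊎ ∃ λ y' → Legal D' y' × play G D y ≼ play G D' y'
  matching-move {D' = D'} D≼D' y with T? (legal G D' y)
  ... | yes ly = inj₂ (y , ly , play-mono D≼D' y)
  ... | no ¬ly with any? (λ w → T? (legal G D' w))
  ...   | yes (z , lz) = inj₂ (z , lz , ≼-play (play-illegal D≼D' ¬ly) z)
  ...   | no none      = inj₁ (λ w lw → none (w , lw))

  value-monotone : ∀ {k k'} p {D D'} → k ≤ k' → D ≼ D' → value G k p D' ≤ value G k' p D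
  value-monotone {zero} p _ _ = z≤n
  value-monotone {suc k} {suc k'} Dominator {D} {D'} (s≤s k≤k') D≼D'
    with value-attained k' Dominator D
  ... | inj₁ stuck = value-stuck-≤ k Dominator (λ w → stuck w ∘ legal-antitone D≼D')
  ... | inj₂ (y , _ , eq) with matching-move D≼D' y
  ...   | inj₁ stuck' = value-stuck-≤ k Dominator stuck'
  ...   | inj₂ (y' , ly' , after≼) = begin
    value G (suc k) Dominator D'             ≤⟨ value-Dominator-≤ k ly' ⟩
    suc (value G k Staller (play G D' y'))   ≤⟨ s≤s (value-monotone Staller k≤k' after≼) ⟩
    suc (value G k' Staller (play G D y))    ≡⟨ sym eq ⟩
    value G (suc k') Dominator D             ∎
    where open ≤-Reasoning
  value-monotone {suc k} {suc k'} Staller {D} {D'} (s≤s k≤k') D≼D'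
    with value-attained k Staller D'
  ... | inj₁ stuck' = value-stuck-≤ k Staller stuck'
  ... | inj₂ (y , ly' , eq) = begin
    value G (suc k) Staller D'                ≡⟨ eq ⟩
    suc (value G k Dominator (play G D' y))   ≤⟨ s≤s (value-monotone Dominator k≤k' (play-mono D≼D' y)) ⟩
    suc (value G k' Dominator (play G D y))   ≤⟨ value-Staller-≥ k' (legal-antitone D≼D' ly') ⟩
    value G (suc k') Staller D                ∎
    where open ≤-Reasoning

  _∪｛_｝ : VSet n → Fin n → VSet n
  (D ∪｛ v ｝) u = D u ∨ ｛ v ｝ u

  ∈｛｝ : ∀ {u v : Fin n} → T (｛ v ｝ u) → u ≡ v
  ∈｛｝ {u} {v} = toWitness {a? = u ≟ v}

  ∪-absorbed : ∀ {D v} → (∀ w → T (adj G w v) → T (D v)) → (D ∪｛ v ｝) ≼ D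
  ∪-absorbed {D} {v} hyp w u w~u h with to T-∨ h
  ... | inj₁ u∈D = u∈D
  ... | inj₂ u∈v with ∈｛｝ {u} {v} u∈v
  ...   | refl = hyp w w~u

  ∪-covered : ∀ {D u v} → T (adj G u v) → (D ∪｛ v ｝) ≼ play G D u
  ∪-covered {D} {v = v} u~v w x w~x h with to T-∨ h
  ... | inj₁ x∈D = from T-∨ (inj₁ x∈D)
  ... | inj₂ x∈v with ∈｛｝ {x} {v} x∈v
  ...   | refl = from T-∨ (inj₂ u~v)

  predominate-absorbed : ∀ {D v} → (∀ w → T (adj G w v) → T (D v)) → ∀ k →
    value G k Dominator D ≤ value G k Dominator (D ∪｛ v ｝)
  predominate-absorbed {D} {v} hyp k =
    value-monotone Dominator {D ∪｛ v ｝} {D} (≤-refl {k}) (∪-absorbed hyp)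

  -- Otherwise Dominator opens with a neighbour u of v; after Staller's reply
  -- the position is at least as advanced as D ∪ {v}.
  predominate-neighbour : ∀ {D u v} → T (adj G u v) → ¬ T (D v) → ∀ k →
    value G k Dominator D ≤ value G k Dominator (D ∪｛ v ｝) + 2
  predominate-neighbour _ _ zero = z≤n
  predominate-neighbour {D} {u} {v} u~v v∉D (suc k) = begin
    value G (suc k) Dominator D                 ≤⟨ value-Dominator-≤ k (legal-intro u~v v∉D) ⟩
    suc (value G k Staller (play G D u))        ≤⟨ s≤s (staller-reply k) ⟩
    suc (suc (value G (suc k) Dominator D⁺))    ≡⟨ +-comm 2 _ ⟩
    value G (suc k) Dominator D⁺ + 2            ∎
    where
    open ≤-Reasoning
    D⁺ : VSet n
    D⁺ = D ∪｛ v ｝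
    -- Every Staller reply y gives D⁺ ≼ play (play D u) y; the budget drops
    -- by two, which value-monotone absorbs.
    staller-reply : ∀ j → value G j Staller (play G D u) ≤ suc (value G (suc j) Dominator D⁺)
    staller-reply zero    = z≤n
    staller-reply (suc j) = value-Staller-≤ j λ y _ →
      value-monotone Dominator (m≤n+m j 2) (≼-play (∪-covered u~v) y)

  predominate-vertex : ∀ k D v →
    value G k Dominator D ≤ value G k Dominator (D ∪｛ v ｝) + 2
  predominate-vertex k D v with T? (D v) | any? (λ u → T? (adj G u v))
  ... | no v∉D  | yes (u , u~v) = predominate-neighbour u~v v∉D k
  ... | yes v∈D | _             =
    ≤-trans (predominate-absorbed (λ _ _ → v∈D) k) (m≤m+n _ 2)
  ... | no _    | no isolated   =
    ≤-trans (predominate-absorbed (λ w w~v → ⊥-elim (isolated (w , w~v))) k) (m≤m+n _ 2)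

lemma2p1 : (n : ℕ) (G : Graph n) (v : Fin n) →
    γgt G ∅ ≤ γgt G ｛ v ｝ + 2
lemma2p1 n G v = predominate-vertex G n ∅ v
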